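{- Let $m_1,m_2$ be positive integers with $m_1 \neq m_2$, and let $G \in ER(n,d,m_1+m_2)$ have a uniform shared neighborhood structure. Then this uniform shared neighborhood structure is not isomorphic to the complete bipartite graph $K_{m_1,m_2}$.
   Context: For a finite simple graph $G$, $N(u)$ is the open neighborhood of a vertex $u$. $G \in ER(n,d,\lambda)$ means $G$ has $n$ vertices, is $d$-regular, and every pair of adjacent vertices has exactly $\lambda$ common neighbors. $G$ has a uniform shared neighborhood structure isomorphic to $H$ if the induced subgraph $G[N(u)\cap N(v)]$ is isomorphic to $H$ for all adjacent $u,v$. -}

module Defs where

open import Data.Nat using (ℕ; zero; suc; _+_; _<ᵇ_)
open import Data.Fin using (Fin; toℕ)
open import Data.Bool using (Bool; true; false; _∧_; _xor_; if_then_else_)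
open import Data.List using (List; map; allFin)
open import Data.Nat.ListAction using (sum)
open import Data.Product using (Σ; ∃; _×_; _,_)
open import Relation.Binary.PropositionalEquality using (_≡_; refl)

record SimpleGraph (n : ℕ) : Set where
  field
    adj     : Fin n → Fin n → Bool
    sym     : ∀ u v → adj u v ≡ adj v u
    irrefl  : ∀ u → adj u u ≡ false

open SimpleGraph public

Adj : ∀ {n} → SimpleGraph n → Fin n → Fin n → Set
Adj G u v = adj G u v ≡ true

count : ∀ n → (Fin n → Bool) → ℕ
count n P = sum (map (λ w → if P w then 1 else 0) (allFin n))

shared : ∀ {n} → SimpleGraph n → Fin n → Fin n → Fin n → Bool
shared G u v w = adj G u w ∧ adj G v w

degree : ∀ {n} → SimpleGraph n → Fin n → ℕ
degree {n} G u = count n (adj G u)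

IsER : (n d λ′ : ℕ) → SimpleGraph n → Set
IsER n d λ′ G =
  (∀ u → degree G u ≡ d) ×
  (∀ u v → Adj G u v → count n (shared G u v) ≡ λ′)

record InducedIso {n k : ℕ} (G : SimpleGraph n) (S : Fin n → Bool)
                  (H : SimpleGraph k) : Set where
  field
    f        : Fin k → Fin n
    inj      : ∀ i j → f i ≡ f j → i ≡ j
    into     : ∀ i → S (f i) ≡ true
    onto     : ∀ w → S w ≡ true → Σ (Fin k) (λ i → f i ≡ w)
    pres     : ∀ i j → adj G (f i) (f j) ≡ adj H i j

record GraphIso {k k′ : ℕ} (H : SimpleGraph k) (H′ : SimpleGraph k′) : Set where
  field
    to       : Fin k → Fin k′
    from     : Fin k′ → Fin k
    from-to  : ∀ i → from (to i) ≡ i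
    to-from  : ∀ j → to (from j) ≡ j
    pres     : ∀ i j → adj H′ (to i) (to j) ≡ adj H i j

UniformSNS : ∀ {n k} → SimpleGraph n → SimpleGraph k → Set
UniformSNS G H = ∀ u v → Adj G u v → InducedIso G (shared G u v) H

-- complete bipartite graph K_{m₁,m₂} on Fin (m₁ + m₂):
-- the parts are {i | toℕ i < m₁} and {i | toℕ i ≥ m₁}
private
  xor-comm′ : ∀ x y → x xor y ≡ y xor x
  xor-comm′ true true = refl
  xor-comm′ true false = refl
  xor-comm′ false true = refl
  xor-comm′ false false = refl

  xor-self : ∀ x → x xor x ≡ false
  xor-self true = refl
  xor-self false = refl

CompleteBipartite : (m₁ m₂ : ℕ) → SimpleGraph (m₁ + m₂)
CompleteBipartite m₁ m₂ = record
  { adj    = λ i j → (toℕ i <ᵇ m₁) xor (toℕ j <ᵇ m₁)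
  ; sym    = λ i j → xor-comm′ (toℕ i <ᵇ m₁) (toℕ j <ᵇ m₁)
  ; irrefl = λ i → xor-self (toℕ i <ᵇ m₁)
  }

{-# OPTIONS --safe #-}
module Submission where

open import Algebra.Bundles using (CommutativeMonoid)
open import Data.Bool using (Bool; true; false; not; _∧_; if_then_else_)
open import Data.Bool.Properties using (∧-conicalˡ; ∧-conicalʳ; ∧-commutativeMonoid)
open import Data.Empty using (⊥)
open import Data.Fin using (Fin; zero; suc; toℕ; _↑ˡ_; _↑ʳ_; fromℕ<)
open import Data.Fin.Properties using (injective⇒≤; suc-injective)
open import Data.List using (allFin)
open import Data.List.Properties using (map-cong; map-tabulate)
open import Data.Nat using (ℕ; zero; suc; _+_; _≤_; _≥_; _<ᵇ_)
open import Data.Nat.ListAction using (sum)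
open import Data.Nat.Properties using (≤-antisym)
open import Data.Product using (Σ; _,_; proj₁; proj₂)
open import Data.Sum using (_⊎_; inj₁; inj₂)
open import Function using (_∘_; id)
open import Relation.Binary.PropositionalEquality
  using (_≡_; _≢_; refl; sym; trans; cong; cong₂; subst; module ≡-Reasoning)
open import Relation.Nullary using (¬_)

open import Defs hiding (sym)
open import Algebra.Properties.CommutativeSemigroup
  (CommutativeMonoid.commutativeSemigroup ∧-commutativeMonoid) using (xy∙z≈xz∙y)

-- For adjacent x, y and z ∈ N(x) ∩ N(y), the number common₃ G x y z of common
-- neighbours of x, y, z is the degree of z in G[N(x) ∩ N(y)] ≅ H. In K_{m₁,m₂} the
-- degree is m₂ on the first part and m₁ on the second, so when m₁ ≢ m₂ it takes two
-- values and differs across every edge. An edge ab of H inside N(u) ∩ N(v) yields a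
-- K₄ on u, v, a, b, and the counts for the triangles uva, uvb, uab are pairwise
-- distinct (compare them inside the common neighbourhoods of uv, ua and ub): three
-- distinct numbers among two values.

-- count, but by recursion on n, so that Fin (card n P) can be enumerated by recursion.
card : ∀ n → (Fin n → Bool) → ℕ
card zero    P = 0
card (suc n) P = if P zero then suc (card n (P ∘ suc)) else card n (P ∘ suc)

enumerate : ∀ n P → Fin (card n P) → Fin n
enumerate (suc n) P i with P zero
enumerate (suc n) P zero    | true  = zero
enumerate (suc n) P (suc i) | true  = suc (enumerate n (P ∘ suc) i)
enumerate (suc n) P i       | false = suc (enumerate n (P ∘ suc) i)

rank : ∀ n P (w : Fin n) → P w ≡ true → Fin (card n P)
rank (suc n) P zero p with P zero
rank (suc n) P zero p  | true  = zero
rank (suc n) P zero () | false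
rank (suc n) P (suc w) p with P zero
... | true  = suc (rank n (P ∘ suc) w p)
... | false = rank n (P ∘ suc) w p

enumerate-sound : ∀ n (P : Fin n → Bool) i → P (enumerate n P i) ≡ true
enumerate-sound (suc n) P i with P zero in eq
enumerate-sound (suc n) P zero    | true  = eq
enumerate-sound (suc n) P (suc i) | true  = enumerate-sound n (P ∘ suc) i
enumerate-sound (suc n) P i       | false = enumerate-sound n (P ∘ suc) i

enumerate-rank : ∀ n (P : Fin n → Bool) w p → enumerate n P (rank n P w p) ≡ w
enumerate-rank (suc n) P zero p with P zero
enumerate-rank (suc n) P zero p  | true  = refl
enumerate-rank (suc n) P zero () | false
enumerate-rank (suc n) P (suc w) p with P zero
... | true  = cong suc (enumerate-rank n (P ∘ suc) w p)
... | false = cong suc (enumerate-rank n (P ∘ suc) w p)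

enumerate-injective : ∀ n (P : Fin n → Bool) i j → enumerate n P i ≡ enumerate n P j → i ≡ j
enumerate-injective (suc n) P i j e with P zero
enumerate-injective (suc n) P zero    zero    e | true = refl
enumerate-injective (suc n) P (suc i) (suc j) e | true =
  cong suc (enumerate-injective n (P ∘ suc) i j (suc-injective e))
enumerate-injective (suc n) P i       j       e | false =
  enumerate-injective n (P ∘ suc) i j (suc-injective e)

card-≤-injection : ∀ {n k} (P : Fin n → Bool) (Q : Fin k → Bool)
                   (φ : ∀ w → P w ≡ true → Fin k) →
                   (∀ w p → Q (φ w p) ≡ true) →
                   (∀ {w w′} p p′ → φ w p ≡ φ w′ p′ → w ≡ w′) →
                   card n P ≤ card k Q
card-≤-injection {n} {k} P Q φ φ-into φ-injective = injective⇒≤ ψ-injective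
  where
  ψ : Fin (card n P) → Fin (card k Q)
  ψ i = rank k Q (φ (enumerate n P i) (enumerate-sound n P i)) (φ-into _ _)

  ψ-injective : ∀ {i j} → ψ i ≡ ψ j → i ≡ j
  ψ-injective {i} {j} e = enumerate-injective n P i j (φ-injective _ _ (begin
    φ _ _                  ≡⟨ sym (enumerate-rank k Q _ _) ⟩
    enumerate k Q (ψ i)    ≡⟨ cong (enumerate k Q) e ⟩
    enumerate k Q (ψ j)    ≡⟨ enumerate-rank k Q _ _ ⟩
    φ _ _                  ∎))
    where open ≡-Reasoning

count-suc : ∀ {n} (P : Fin (suc n) → Bool) →
            count (suc n) P ≡ (if P zero then 1 else 0) + count n (P ∘ suc)
count-suc {n} P = cong (λ xs → indicator zero + sum xs)
  (trans (map-tabulate suc indicator) (sym (map-tabulate id (indicator ∘ suc))))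
  where
  indicator : Fin (suc n) → ℕ
  indicator w = if P w then 1 else 0

count≡card : ∀ n (P : Fin n → Bool) → count n P ≡ card n P
count≡card zero    P = refl
count≡card (suc n) P with P zero | count-suc P
... | true  | e = trans e (cong suc (count≡card n (P ∘ suc)))
... | false | e = trans e (count≡card n (P ∘ suc))

count-cong : ∀ {n} {P Q : Fin n → Bool} → (∀ w → P w ≡ Q w) → count n P ≡ count n Q
count-cong {n} P≗Q = cong sum (map-cong (λ w → cong (λ b → if b then 1 else 0) (P≗Q w)) (allFin n))

count-image : ∀ {n k} (S : Fin n → Bool) (f : Fin k → Fin n) →
              (∀ i j → f i ≡ f j → i ≡ j) →
              (∀ i → S (f i) ≡ true) →
              (∀ w → S w ≡ true → Σ (Fin k) (λ i → f i ≡ w)) →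
              (R : Fin n → Bool) → count n (λ w → S w ∧ R w) ≡ count k (R ∘ f)
count-image {n} {k} S f f-injective f-into f-onto R = begin
  count n S∧R     ≡⟨ count≡card n S∧R ⟩
  card n S∧R      ≡⟨ ≤-antisym
                       (card-≤-injection S∧R (R ∘ f) preimage preimage-into preimage-injective)
                       (card-≤-injection (R ∘ f) S∧R (λ i _ → f i) image-into (λ _ _ → f-injective _ _)) ⟩
  card k (R ∘ f)  ≡⟨ sym (count≡card k (R ∘ f)) ⟩
  count k (R ∘ f) ∎
  where
  open ≡-Reasoning
  S∧R : Fin n → Bool
  S∧R w = S w ∧ R w

  preimage : ∀ w → S∧R w ≡ true → Fin k
  preimage w p = proj₁ (f-onto w (∧-conicalˡ _ _ p))

  f-preimage : ∀ w p → f (preimage w p) ≡ w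
  f-preimage w p = proj₂ (f-onto w (∧-conicalˡ _ _ p))

  preimage-into : ∀ w p → R (f (preimage w p)) ≡ true
  preimage-into w p = trans (cong R (f-preimage w p)) (∧-conicalʳ _ _ p)

  preimage-injective : ∀ {w w′} p p′ → preimage w p ≡ preimage w′ p′ → w ≡ w′
  preimage-injective p p′ e = trans (sym (f-preimage _ p)) (trans (cong f e) (f-preimage _ p′))

  image-into : ∀ i (p : R (f i) ≡ true) → S∧R (f i) ≡ true
  image-into i p rewrite f-into i = p

Adj-sym : ∀ {n} (G : SimpleGraph n) {x y} → Adj G x y → Adj G y x
Adj-sym G {x} {y} xy = trans (SimpleGraph.sym G y x) xy

shared-intro : ∀ {n} (G : SimpleGraph n) {x y w} → Adj G x w → Adj G y w → shared G x y w ≡ true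
shared-intro G xw yw rewrite xw = yw

shared-left : ∀ {n} (G : SimpleGraph n) {x y w} → shared G x y w ≡ true → Adj G x w
shared-left G = ∧-conicalˡ _ _

shared-right : ∀ {n} (G : SimpleGraph n) {x y w} → shared G x y w ≡ true → Adj G y w
shared-right G = ∧-conicalʳ _ _

module _ {k k′} {H : SimpleGraph k} {H′ : SimpleGraph k′} (σ : GraphIso H H′) where
  open GraphIso σ

  to-preserves-adj : ∀ {i j} → Adj H i j → Adj H′ (to i) (to j)
  to-preserves-adj {i} {j} = trans (pres i j)

  from-preserves-adj : ∀ {i j} → Adj H′ i j → Adj H (from i) (from j)
  from-preserves-adj {i} {j} ij =
    trans (sym (pres (from i) (from j))) (trans (cong₂ (adj H′) (to-from i) (to-from j)) ij)

  to-preserves-degree : ∀ i → degree H′ (to i) ≡ degree H i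
  to-preserves-degree i = trans
    (count-image (λ _ → true) to to-injective (λ _ → refl) (λ j _ → from j , to-from j) (adj H′ (to i)))
    (count-cong (pres i))
    where
    to-injective : ∀ i j → to i ≡ to j → i ≡ j
    to-injective i j e = trans (sym (from-to i)) (trans (cong from e) (from-to j))

induced-degree : ∀ {n k} {G : SimpleGraph n} {S : Fin n → Bool} {H : SimpleGraph k}
                 (ι : InducedIso G S H) → let open InducedIso ι in
                 ∀ i → count n (λ w → S w ∧ adj G (f i) w) ≡ degree H i
induced-degree {G = G} {S = S} ι i =
  trans (count-image S f inj into onto (adj G (f i))) (count-cong (pres i))
  where open InducedIso ι

↑ˡ-<ᵇ : ∀ {m} (i : Fin m) r → (toℕ (i ↑ˡ r) <ᵇ m) ≡ true
↑ˡ-<ᵇ zero    r = refl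
↑ˡ-<ᵇ (suc i) r = ↑ˡ-<ᵇ i r

↑ʳ-≮ᵇ : ∀ m {r} (j : Fin r) → (toℕ (m ↑ʳ j) <ᵇ m) ≡ false
↑ʳ-≮ᵇ zero    j = refl
↑ʳ-≮ᵇ (suc m) j = ↑ʳ-≮ᵇ m j

CompleteBipartite-across : ∀ {m₁ m₂} (i : Fin m₁) (j : Fin m₂) →
                           Adj (CompleteBipartite m₁ m₂) (i ↑ˡ m₂) (m₁ ↑ʳ j)
CompleteBipartite-across {m₁} {m₂} i j rewrite ↑ˡ-<ᵇ i m₂ | ↑ʳ-≮ᵇ m₁ j = refl

card-all : ∀ n → card n (λ _ → true) ≡ n
card-all zero    = refl
card-all (suc n) = cong suc (card-all n)

card-none : ∀ n → card n (λ _ → false) ≡ 0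
card-none zero    = refl
card-none (suc n) = card-none n

card-below : ∀ m r → card (m + r) (λ j → toℕ j <ᵇ m) ≡ m
card-below zero    r = card-none r
card-below (suc m) r = cong suc (card-below m r)

card-not-below : ∀ m r → card (m + r) (λ j → not (toℕ j <ᵇ m)) ≡ r
card-not-below zero    r = card-all r
card-not-below (suc m) r = card-not-below m r

degree-CompleteBipartite : ∀ m₁ m₂ j →
  degree (CompleteBipartite m₁ m₂) j ≡ (if toℕ j <ᵇ m₁ then m₂ else m₁)
degree-CompleteBipartite m₁ m₂ j with toℕ j <ᵇ m₁
... | true  = trans (count≡card (m₁ + m₂) _) (card-not-below m₁ m₂)
... | false = trans (count≡card (m₁ + m₂) _) (card-below m₁ m₂)

record DegreeTwoColouring {k} (H : SimpleGraph k) (d₁ d₂ : ℕ) : Set where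
  field
    two-valued : ∀ i → degree H i ≡ d₁ ⊎ degree H i ≡ d₂
    proper     : ∀ {i j} → Adj H i j → degree H i ≢ degree H j

DegreeTwoColouring-iso : ∀ {k k′} {H : SimpleGraph k} {H′ : SimpleGraph k′} {d₁ d₂} →
                         GraphIso H H′ → DegreeTwoColouring H′ d₁ d₂ → DegreeTwoColouring H d₁ d₂
DegreeTwoColouring-iso {d₁ = d₁} {d₂} σ c = record
  { two-valued = λ i → subst (λ d → d ≡ d₁ ⊎ d ≡ d₂) (to-preserves-degree σ i) (two-valued (to i))
  ; proper     = λ {i} {j} ij e → proper (to-preserves-adj σ ij)
      (trans (to-preserves-degree σ i) (trans e (sym (to-preserves-degree σ j))))
  }
  where
  open GraphIso σ
  open DegreeTwoColouring c

CompleteBipartite-degreeTwoColouring : ∀ {m₁ m₂} → m₁ ≢ m₂ →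
  DegreeTwoColouring (CompleteBipartite m₁ m₂) m₁ m₂
CompleteBipartite-degreeTwoColouring {m₁} {m₂} m₁≢m₂ = record
  { two-valued = two-valued
  ; proper     = proper
  }
  where
  two-valued : ∀ j → degree (CompleteBipartite m₁ m₂) j ≡ m₁ ⊎ degree (CompleteBipartite m₁ m₂) j ≡ m₂
  two-valued j rewrite degree-CompleteBipartite m₁ m₂ j with toℕ j <ᵇ m₁
  ... | true  = inj₂ refl
  ... | false = inj₁ refl

  proper : ∀ {i j} → Adj (CompleteBipartite m₁ m₂) i j →
           degree (CompleteBipartite m₁ m₂) i ≢ degree (CompleteBipartite m₁ m₂) j
  proper {i} {j} ij
    rewrite degree-CompleteBipartite m₁ m₂ i | degree-CompleteBipartite m₁ m₂ j
    with toℕ i <ᵇ m₁ | toℕ j <ᵇ m₁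
  ... | true  | false = m₁≢m₂ ∘ sym
  ... | false | true  = m₁≢m₂

no-three-distinct-in-pair : ∀ {A : Set} {a b x y z : A} →
  x ≡ a ⊎ x ≡ b → y ≡ a ⊎ y ≡ b → z ≡ a ⊎ z ≡ b → x ≢ y → x ≢ z → y ≢ z → ⊥
no-three-distinct-in-pair (inj₁ refl) (inj₁ refl) _           x≢y _   _   = x≢y refl
no-three-distinct-in-pair (inj₂ refl) (inj₂ refl) _           x≢y _   _   = x≢y refl
no-three-distinct-in-pair (inj₁ refl) (inj₂ refl) (inj₁ refl) _   x≢z _   = x≢z refl
no-three-distinct-in-pair (inj₁ refl) (inj₂ refl) (inj₂ refl) _   _   y≢z = y≢z refl
no-three-distinct-in-pair (inj₂ refl) (inj₁ refl) (inj₁ refl) _   _   y≢z = y≢z refl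
no-three-distinct-in-pair (inj₂ refl) (inj₁ refl) (inj₂ refl) _   x≢z _   = x≢z refl

common₃ : ∀ {n} → SimpleGraph n → Fin n → Fin n → Fin n → ℕ
common₃ {n} G x y z = count n (λ w → shared G x y w ∧ adj G z w)

common₃-swap : ∀ {n} (G : SimpleGraph n) x y z → common₃ G x y z ≡ common₃ G x z y
common₃-swap G x y z = count-cong (λ w → xy∙z≈xz∙y (adj G x w) (adj G y w) (adj G z w))

module _ {n k} {G : SimpleGraph n} {H : SimpleGraph k} (sns : UniformSNS G H)
         {d₁ d₂ : ℕ} (c : DegreeTwoColouring H d₁ d₂) where
  open DegreeTwoColouring c

  common₃-two-valued : ∀ {x y z} → Adj G x y → shared G x y z ≡ true →
                       common₃ G x y z ≡ d₁ ⊎ common₃ G x y z ≡ d₂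
  common₃-two-valued xy p with InducedIso.onto (sns _ _ xy) _ p
  ... | i , refl rewrite induced-degree (sns _ _ xy) i = two-valued i

  common₃-distinct : ∀ {x y z z′} → Adj G x y → shared G x y z ≡ true → shared G x y z′ ≡ true →
                     Adj G z z′ → common₃ G x y z ≢ common₃ G x y z′
  common₃-distinct xy p p′ zz′ with InducedIso.onto (sns _ _ xy) _ p | InducedIso.onto (sns _ _ xy) _ p′
  ... | i , refl | j , refl
    rewrite induced-degree (sns _ _ xy) i | induced-degree (sns _ _ xy) j =
    proper (trans (sym (InducedIso.pres (sns _ _ xy) i j)) zz′)

  shared-neighbourhood-edgeless : ∀ {u v i j} → Adj G u v → Adj H i j → ⊥
  shared-neighbourhood-edgeless {u} {v} {i} {j} uv ij = no-three-distinct-in-pair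
    (common₃-two-valued uv a∈uv) (common₃-two-valued uv b∈uv) (common₃-two-valued ua b∈ua)
    (common₃-distinct uv a∈uv b∈uv ab)
    (λ e → common₃-distinct ua v∈ua b∈ua vb (trans (common₃-swap G u a v) e))
    (λ e → common₃-distinct ub v∈ub a∈ub va
             (trans (common₃-swap G u b v) (trans e (common₃-swap G u a b))))
    where
    open InducedIso (sns u v uv)
    a b : Fin n
    a = f i
    b = f j
    a∈uv : shared G u v a ≡ true
    a∈uv = into i
    b∈uv : shared G u v b ≡ true
    b∈uv = into j
    ab : Adj G a b
    ab = trans (pres i j) ij
    ua : Adj G u a
    ua = shared-left G a∈uv
    va : Adj G v a
    va = shared-right G a∈uv
    ub : Adj G u b
    ub = shared-left G b∈uv
    vb : Adj G v b
    vb = shared-right G b∈uv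
    v∈ua : shared G u a v ≡ true
    v∈ua = shared-intro G uv (Adj-sym G va)
    b∈ua : shared G u a b ≡ true
    b∈ua = shared-intro G ub ab
    v∈ub : shared G u b v ≡ true
    v∈ub = shared-intro G uv (Adj-sym G vb)
    a∈ub : shared G u b a ≡ true
    a∈ub = shared-intro G ua (Adj-sym G ab)

theorem5 : (m₁ m₂ : ℕ) → m₁ ≥ 1 → m₂ ≥ 1 → m₁ ≢ m₂ →
           (n d : ℕ) (G : SimpleGraph n) → IsER n d (m₁ + m₂) G →
           (k : ℕ) (H : SimpleGraph k) → UniformSNS G H →
           Σ (Fin n) (λ u → Σ (Fin n) (λ v → Adj G u v)) →
           ¬ GraphIso H (CompleteBipartite m₁ m₂)
theorem5 m₁ m₂ m₁≥1 m₂≥1 m₁≢m₂ _ _ _ _ _ _ sns (_ , _ , uv) σ =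
  shared-neighbourhood-edgeless sns (DegreeTwoColouring-iso σ (CompleteBipartite-degreeTwoColouring m₁≢m₂)) uv
    (from-preserves-adj σ (CompleteBipartite-across (fromℕ< m₁≥1) (fromℕ< m₂≥1)))
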